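{- Let $(\mathcal{W},\rhd)$ be a well-founded frame and consider the interpretation $\mathcal I$ in this frame. If $A\cong B$, then $\mathcal{I}(A)^{\eta}=\mathcal{I}(B)^{\eta}$ (i.e. $\mathcal I(A)^\eta_p=\mathcal I(B)^\eta_p$ for every $p\in\mathcal W$) for every hereditary type environment $\eta$.
   Context: Type expressions. Fix a countably infinite set of type variables. Pseudo type expressions: $A::=X\mid A\to B\mid \bullet A\mid \mu X.A$ ($\alpha$-convertible expressions identified; $A[B/X]$ capture-avoiding substitution). $\top:=\mu X.\bullet X$; $\bullet^nA$ is $A$ preceded by $n$ bullets. Tail: $t(X)=X$, $t(A\to B)=t(B)$, $t(\bullet A)=\bullet t(A)$, $t(\mu X.A)=\mu X.t(A)$. $A$ is a $\top$-variant iff $t(A)=\bullet^{m_0}\mu X_1.\bullet^{m_1}\cdots\mu X_n.\bullet^{m_n}X_i$ with $1\le i\le n$, $X_i\notin\{X_{i+1},\dots,X_n\}$, $m_i+\dots+m_n\ge1$. Properness: variable $Y$ is proper in $X$ iff $Y\ne X$; $\bullet A$ is proper in $X$; $A\to B$ is proper in $X$ iff both $A,B$ are or $B$ is a $\top$-variant; for $Y\ne X$, $\mu Y.A$ is proper in $X$ iff $A$ is or $\mu Y.A$ is a $\top$-variant. Type expressions: pseudo type expressions where every subexpression $\mu X.A$ has $A$ proper in $X$. Equality $\cong$: the smallest relation on type expressions closed under: $A\cong A$; symmetry; transitivity; $A\cong B\Rightarrow\bullet A\cong\bullet B$; $A\cong C,\ B\cong D\Rightarrow A\to B\cong C\to D$;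 $A\to\top\cong\top$; $\mu X.A\cong A[\mu X.A/X]$; if $A\cong C[A/X]$ and $C$ is proper in $X$ then $A\cong\mu X.C$. Semantics. Fix a syntactical $\lambda$-algebra $(\mathcal V,\cdot,[\![\,]\!])$ (nonempty $\mathcal V$, binary $\cdot$, $[\![M]\!]_\rho\in\mathcal V$ for $\lambda$-terms $M$ and $\rho:\mathrm{Var}\to\mathcal V$ with $[\![x]\!]_\rho=\rho(x)$, $[\![MN]\!]_\rho=[\![M]\!]_\rho\cdot[\![N]\!]_\rho$, $[\![\lambda x.M]\!]_\rho\cdot v=[\![M]\!]_{\rho[v/x]}$, dependence only on free variables, invariance under $=_\beta$). A well-founded frame $(\mathcal W,\rhd)$: nonempty $\mathcal W$ with no infinite chain $p_0\rhd p_1\rhd\cdots$; $\unrhd^*$ is the reflexive transitive closure of $\rhd$. A type environment $\eta$ gives $\eta(X)_p\subseteq\mathcal V$; hereditary iff $p\rhd q\Rightarrow\eta(X)_p\subseteq\eta(X)_q$. Interpretation: $\mathcal I(A)^\eta_p=\mathcal V$ if $A$ is a $\top$-variant; otherwise $\mathcal I(X)^\eta_p=\eta(X)_p$; $\mathcal I(\bullet A)^\eta_p=\{u\mid\forall q\,(p\rhd q\Rightarrow u\in\mathcal I(A)^\eta_q)\}$; $\mathcal I(A\to B)^\eta_p=\{u\mid\forall q\,(p\unrhd^*q)\ \forall v\in\mathcal I(A)^\eta_q:\ u\cdot v\in\mathcal I(B)^\eta_q\}$; $\mathcal I(\mu X.A)^\eta_p=\mathcal I(A[\mu X.A/X])^\eta_p$.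 -}

module Defs where

open import Data.Nat using (ℕ; zero; suc; _+_)
open import Data.Bool using (Bool; true; false; if_then_else_; T)
open import Data.List using (List; []; _∷_; map)
open import Data.Empty using (⊥)
open import Data.Unit using (⊤)
open import Data.Product using (_×_)
open import Relation.Binary.PropositionalEquality using (_≡_; _≢_)
open import Relation.Binary.Construct.Closure.ReflexiveTransitive using (Star; ε; _◅_)
open import Induction.WellFounded using (WellFounded; Acc; acc)

-- Pseudo type expressions, de Bruijn (unscoped: variables are ℕ,
-- a countably infinite set).  α-convertible expressions are identified
-- automatically by the de Bruijn representation.

infixr 7 _⇒_

data Ty : Set where
  var : ℕ → Ty
  _⇒_ : Ty → Ty → Ty
  ●   : Ty → Ty
  μ   : Ty → Ty

extR : (ℕ → ℕ) → ℕ → ℕ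
extR ρ zero    = zero
extR ρ (suc i) = suc (ρ i)

ren : (ℕ → ℕ) → Ty → Ty
ren ρ (var x) = var (ρ x)
ren ρ (A ⇒ B) = ren ρ A ⇒ ren ρ B
ren ρ (● A)   = ● (ren ρ A)
ren ρ (μ A)   = μ (ren (extR ρ) A)

extS : (ℕ → Ty) → ℕ → Ty
extS σ zero    = var zero
extS σ (suc i) = ren suc (σ i)

sub : (ℕ → Ty) → Ty → Ty
sub σ (var x) = σ x
sub σ (A ⇒ B) = sub σ A ⇒ sub σ B
sub σ (● A)   = ● (sub σ A)
sub σ (μ A)   = μ (sub (extS σ) A)

sub0 : Ty → ℕ → Ty
sub0 B zero    = B
sub0 B (suc i) = var i

-- A [ B ] : substitute B for the variable bound by an enclosing μ
-- (index 0) in the body A, i.e. A[B/X] for μX.A.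
_[_] : Ty → Ty → Ty
A [ B ] = sub (sub0 B) A

Top : Ty
Top = μ (● (var zero))

bullets : ℕ → Ty → Ty
bullets zero    A = A
bullets (suc n) A = ● (bullets n A)

tail : Ty → Ty
tail (var x) = var x
tail (A ⇒ B) = tail B
tail (● A)   = ● (tail A)
tail (μ A)   = μ (tail A)

-- ⊤-variants.  t(A) = •^{m0} μX1.•^{m1} ⋯ μXn.•^{mn} Xi with Xi bound by
-- the i-th μ (not shadowed) and m_i + ⋯ + m_n ≥ 1.  We walk the tail
-- keeping, for each enclosing μ (innermost first), a flag saying whether
-- a bullet has occurred since that μ.

lookupB : List Bool → ℕ → Bool
lookupB []       _       = false
lookupB (b ∷ bs) zero    = b
lookupB (b ∷ bs) (suc i) = lookupB bs i

tvSpine : List Bool → Ty → Bool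
tvSpine bs (var j) = lookupB bs j
tvSpine bs (A ⇒ B) = false
tvSpine bs (● A)   = tvSpine (map (λ _ → true) bs) A
tvSpine bs (μ A)   = tvSpine (false ∷ bs) A

isTV : Ty → Bool
isTV A = tvSpine [] (tail A)

TopVariant : Ty → Set
TopVariant A = T (isTV A)

data Proper (x : ℕ) : Ty → Set where
  p-var  : ∀ {y} → y ≢ x → Proper x (var y)
  p-●    : ∀ {A} → Proper x (● A)
  p-⇒    : ∀ {A B} → Proper x A → Proper x B → Proper x (A ⇒ B)
  p-⇒tv  : ∀ {A B} → TopVariant B → Proper x (A ⇒ B)
  p-μ    : ∀ {A} → Proper (suc x) A → Proper x (μ A)
  p-μtv  : ∀ {A} → TopVariant (μ A) → Proper x (μ A)

data TypeExpr : Ty → Set where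
  te-var : ∀ {x} → TypeExpr (var x)
  te-⇒   : ∀ {A B} → TypeExpr A → TypeExpr B → TypeExpr (A ⇒ B)
  te-●   : ∀ {A} → TypeExpr A → TypeExpr (● A)
  te-μ   : ∀ {A} → Proper zero A → TypeExpr A → TypeExpr (μ A)

infix 4 _≅_

data _≅_ : Ty → Ty → Set where
  ≅-refl   : ∀ {A} → TypeExpr A → A ≅ A
  ≅-sym    : ∀ {A B} → A ≅ B → B ≅ A
  ≅-trans  : ∀ {A B C} → A ≅ B → B ≅ C → A ≅ C
  ≅-●      : ∀ {A B} → A ≅ B → ● A ≅ ● B
  ≅-⇒      : ∀ {A B C D} → A ≅ C → B ≅ D → (A ⇒ B) ≅ (C ⇒ D)
  ≅-⊤      : ∀ {A} → TypeExpr A → (A ⇒ Top) ≅ Top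
  ≅-unfold : ∀ {A} → TypeExpr (μ A) → μ A ≅ A [ μ A ]
  ≅-fix    : ∀ {A C} → TypeExpr C → Proper zero C → A ≅ C [ A ] → A ≅ μ C

infixl 7 _·_

data Λ : Set where
  `_  : ℕ → Λ
  ƛ   : Λ → Λ
  _·_ : Λ → Λ → Λ

renΛ : (ℕ → ℕ) → Λ → Λ
renΛ ρ (` x)   = ` ρ x
renΛ ρ (ƛ M)   = ƛ (renΛ (extR ρ) M)
renΛ ρ (M · N) = renΛ ρ M · renΛ ρ N

extSΛ : (ℕ → Λ) → ℕ → Λ
extSΛ σ zero    = ` zero
extSΛ σ (suc i) = renΛ suc (σ i)

subΛ : (ℕ → Λ) → Λ → Λ
subΛ σ (` x)   = σ x
subΛ σ (ƛ M)   = ƛ (subΛ (extSΛ σ) M)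
subΛ σ (M · N) = subΛ σ M · subΛ σ N

sub0Λ : Λ → ℕ → Λ
sub0Λ N zero    = N
sub0Λ N (suc i) = ` i

infix 4 _=β_

data _=β_ : Λ → Λ → Set where
  β      : ∀ {M N} → (ƛ M) · N =β subΛ (sub0Λ N) M
  β-refl  : ∀ {M} → M =β M
  β-sym   : ∀ {M N} → M =β N → N =β M
  β-trans : ∀ {M N P} → M =β N → N =β P → M =β P
  β-app   : ∀ {M M' N N'} → M =β M' → N =β N' → M · N =β M' · N'
  β-lam   : ∀ {M M'} → M =β M' → ƛ M =β ƛ M'

data _∈FV_ : ℕ → Λ → Set where
  fv-var : ∀ {x} → x ∈FV (` x)
  fv-lam : ∀ {x M} → suc x ∈FV M → x ∈FV ƛ M
  fv-appˡ : ∀ {x M N} → x ∈FV M → x ∈FV (M · N)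
  fv-appʳ : ∀ {x M N} → x ∈FV N → x ∈FV (M · N)

-- ρ[v/x] for the variable bound by λ (de Bruijn index 0)
_∷ₑ_ : {V : Set} → V → (ℕ → V) → ℕ → V
(v ∷ₑ ρ) zero    = v
(v ∷ₑ ρ) (suc i) = ρ i

record LambdaAlgebra : Set₁ where
  field
    V       : Set
    v₀      : V                       -- V nonempty
    _∙_     : V → V → V
    ⟦_⟧_    : Λ → (ℕ → V) → V
    ⟦var⟧   : ∀ x ρ → ⟦ ` x ⟧ ρ ≡ ρ x
    ⟦app⟧   : ∀ M N ρ → ⟦ M · N ⟧ ρ ≡ (⟦ M ⟧ ρ) ∙ (⟦ N ⟧ ρ)
    ⟦lam⟧   : ∀ M ρ v → (⟦ ƛ M ⟧ ρ) ∙ v ≡ ⟦ M ⟧ (v ∷ₑ ρ)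
    ⟦fv⟧    : ∀ M ρ ρ' → (∀ x → x ∈FV M → ρ x ≡ ρ' x) → ⟦ M ⟧ ρ ≡ ⟦ M ⟧ ρ'
    ⟦β⟧     : ∀ M N ρ → M =β N → ⟦ M ⟧ ρ ≡ ⟦ N ⟧ ρ

-- Well-founded frames: no infinite descending chain p0 ▷ p1 ▷ ⋯,
-- expressed constructively as well-foundedness of q ◁ p :⇔ p ▷ q.

record Frame : Set₁ where
  field
    W   : Set
    w₀  : W                           -- W nonempty
    _▷_ : W → W → Set
    wf  : WellFounded (λ q p → p ▷ q)

module Semantics (𝔸 : LambdaAlgebra) (𝔽 : Frame) where
  open LambdaAlgebra 𝔸
  open Frame 𝔽

  _◁_ : W → W → Set
  q ◁ p = p ▷ q

  _⊵*_ : W → W → Set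
  _⊵*_ = Star _▷_

  Env : Set₁
  Env = ℕ → W → V → Set          -- η(X)_p as a predicate on V

  Hereditary : Env → Set
  Hereditary η = ∀ x {p q} → p ▷ q → ∀ u → η x p u → η x q u

  -- "unguarded size", used only as fuel for unfolding μ at a fixed world
  mutual
    rank : Ty → ℕ
    rank A = if isTV A then 1 else rank′ A

    rank′ : Ty → ℕ
    rank′ (var x) = 1
    rank′ (A ⇒ B) = suc (rank A + rank B)
    rank′ (● A)   = 1
    rank′ (μ A)   = suc (rank A)

  module _ (η : Env) where
    mutual
      -- J a n A : 𝓘(A)_p, computed by recursion on the accessibility
      -- proof a of p and on a fuel n for μ-unfoldings at the same world.
      J : ∀ {p} → Acc _◁_ p → ℕ → Ty → V → Set
      J a n A = if isTV A then (λ _ → ⊤) else J′ a n A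

      J′ : ∀ {p} → Acc _◁_ p → ℕ → Ty → V → Set
      J′ a zero A u = ⊥
      J′ {p} a (suc n) (var x) u = η x p u
      J′ {p} (acc rs) (suc n) (● A) u =
        ∀ q → (h : p ▷ q) → J (rs h) (rank A) A u
      J′ {p} a (suc n) (A ⇒ B) u =
        ∀ q → (path : p ⊵* q) → ∀ v → At a path n A v → At a path n B (u ∙ v)
      J′ a (suc n) (μ A) u = J a n (A [ μ A ]) u

      -- 𝓘(A)_q for q reached from p along a path
      At : ∀ {p q} → Acc _◁_ p → p ⊵* q → ℕ → Ty → V → Set
      At a ε n A = J a n A
      At (acc rs) (h ◅ path) n A = At (rs h) path (rank A) A

  𝓘 : Ty → Env → W → V → Set
  𝓘 A η p = J η (wf p) (rank A) A

module Submission where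

-- All rules but the last are
-- congruences once we know that the fuel-driven definition 𝓘 obeys its
-- defining clauses (the semantic clauses for ⇒, •, μ and ⊤-variants).
-- The fixed-point rule is the heart of the matter: if A ≅ C[A/X] with C
-- proper in X, then A and μX.C agree, by well-founded induction on the
-- world.  Its engine is a contractiveness lemma: substituting σ or τ in a
-- type expression C gives equal interpretations at p as soon as σ and τ
-- agree strictly below p, and agree at p on every variable in which C is
-- not proper.

open import Defs
open import Data.Bool using (Bool; true; false; T; if_then_else_)
open import Data.Bool.Properties using (T-≡)
open import Data.Empty using (⊥-elim)
open import Data.List using (List; []; _∷_; map; length; _++_)
open import Data.List.Properties using (length-map; map-++)
open import Data.Nat using (ℕ; zero; suc; _+_; _≤_; _<_; z≤n; s≤s)
open import Data.Nat.Properties using (≤-refl; ≤-trans; +-mono-≤; suc-injective; m≤m+n; m≤n+m)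
open import Data.Product using (∃; _×_; _,_; proj₁; proj₂)
open import Data.Sum using (_⊎_; inj₁; inj₂; map₁)
open import Data.Unit using (⊤; tt)
open import Function.Base using (const)
open import Function.Bundles using (_⇔_; mk⇔; Equivalence)
open import Function.Properties.Equivalence using () renaming (refl to ⇔-refl; sym to ⇔-sym; trans to ⇔-trans)
open import Induction.WellFounded using (Acc; acc; module All)
open import Level using (0ℓ)
open import Relation.Binary.Construct.Closure.ReflexiveTransitive using (ε; _◅_)
open import Relation.Binary.Construct.Closure.Transitive using (TransClosure; wellFounded) renaming ([_] to [_]⁺; _∷_ to _◅⁺_; _++_ to _◅◅⁺_)
open import Relation.Binary.PropositionalEquality using (_≡_; _≢_; refl; sym; trans; cong; cong₂; subst; subst₂)

open Equivalence using (to; from)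

extR-cong : ∀ {ρ ρ′ : ℕ → ℕ} → (∀ x → ρ x ≡ ρ′ x) → ∀ x → extR ρ x ≡ extR ρ′ x
extR-cong e zero    = refl
extR-cong e (suc x) = cong suc (e x)

ren-cong : ∀ {ρ ρ′ : ℕ → ℕ} → (∀ x → ρ x ≡ ρ′ x) → ∀ A → ren ρ A ≡ ren ρ′ A
ren-cong e (var x) = cong var (e x)
ren-cong e (A ⇒ B) = cong₂ _⇒_ (ren-cong e A) (ren-cong e B)
ren-cong e (● A)   = cong ● (ren-cong e A)
ren-cong e (μ A)   = cong μ (ren-cong (extR-cong e) A)

extS-cong : ∀ {σ σ′ : ℕ → Ty} → (∀ x → σ x ≡ σ′ x) → ∀ x → extS σ x ≡ extS σ′ x
extS-cong e zero    = refl
extS-cong e (suc x) = cong (ren suc) (e x)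

sub-cong : ∀ {σ σ′ : ℕ → Ty} → (∀ x → σ x ≡ σ′ x) → ∀ A → sub σ A ≡ sub σ′ A
sub-cong e (var x) = e x
sub-cong e (A ⇒ B) = cong₂ _⇒_ (sub-cong e A) (sub-cong e B)
sub-cong e (● A)   = cong ● (sub-cong e A)
sub-cong e (μ A)   = cong μ (sub-cong (extS-cong e) A)

ren-ren : ∀ (ρ ρ′ : ℕ → ℕ) A → ren ρ′ (ren ρ A) ≡ ren (λ x → ρ′ (ρ x)) A
ren-ren ρ ρ′ (var x) = refl
ren-ren ρ ρ′ (A ⇒ B) = cong₂ _⇒_ (ren-ren ρ ρ′ A) (ren-ren ρ ρ′ B)
ren-ren ρ ρ′ (● A)   = cong ● (ren-ren ρ ρ′ A)
ren-ren ρ ρ′ (μ A)   = cong μ (trans (ren-ren (extR ρ) (extR ρ′) A) (ren-cong ext A))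
  where
  ext : ∀ x → extR ρ′ (extR ρ x) ≡ extR (λ y → ρ′ (ρ y)) x
  ext zero    = refl
  ext (suc x) = refl

sub-ren : ∀ (ρ : ℕ → ℕ) (τ : ℕ → Ty) A → sub τ (ren ρ A) ≡ sub (λ x → τ (ρ x)) A
sub-ren ρ τ (var x) = refl
sub-ren ρ τ (A ⇒ B) = cong₂ _⇒_ (sub-ren ρ τ A) (sub-ren ρ τ B)
sub-ren ρ τ (● A)   = cong ● (sub-ren ρ τ A)
sub-ren ρ τ (μ A)   = cong μ (trans (sub-ren (extR ρ) (extS τ) A) (sub-cong ext A))
  where
  ext : ∀ x → extS τ (extR ρ x) ≡ extS (λ y → τ (ρ y)) x
  ext zero    = refl
  ext (suc x) = refl

ren-sub : ∀ (σ : ℕ → Ty) (ρ : ℕ → ℕ) A → ren ρ (sub σ A) ≡ sub (λ x → ren ρ (σ x)) A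
ren-sub σ ρ (var x) = refl
ren-sub σ ρ (A ⇒ B) = cong₂ _⇒_ (ren-sub σ ρ A) (ren-sub σ ρ B)
ren-sub σ ρ (● A)   = cong ● (ren-sub σ ρ A)
ren-sub σ ρ (μ A)   = cong μ (trans (ren-sub (extS σ) (extR ρ) A) (sub-cong ext A))
  where
  ext : ∀ x → ren (extR ρ) (extS σ x) ≡ extS (λ y → ren ρ (σ y)) x
  ext zero    = refl
  ext (suc x) = trans (ren-ren suc (extR ρ) (σ x)) (sym (ren-ren ρ suc (σ x)))

sub-sub : ∀ (σ τ : ℕ → Ty) A → sub τ (sub σ A) ≡ sub (λ x → sub τ (σ x)) A
sub-sub σ τ (var x) = refl
sub-sub σ τ (A ⇒ B) = cong₂ _⇒_ (sub-sub σ τ A) (sub-sub σ τ B)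
sub-sub σ τ (● A)   = cong ● (sub-sub σ τ A)
sub-sub σ τ (μ A)   = cong μ (trans (sub-sub (extS σ) (extS τ) A) (sub-cong ext A))
  where
  ext : ∀ x → sub (extS τ) (extS σ x) ≡ extS (λ y → sub τ (σ y)) x
  ext zero    = refl
  ext (suc x) = trans (sub-ren suc (extS τ) (σ x)) (sym (ren-sub τ suc (σ x)))

sub-id : ∀ A → sub var A ≡ A
sub-id (var x) = refl
sub-id (A ⇒ B) = cong₂ _⇒_ (sub-id A) (sub-id B)
sub-id (● A)   = cong ● (sub-id A)
sub-id (μ A)   = cong μ (trans (sub-cong ext A) (sub-id A))
  where
  ext : ∀ x → extS var x ≡ var x
  ext zero    = refl
  ext (suc x) = refl

ren≡sub : ∀ (ρ : ℕ → ℕ) A → ren ρ A ≡ sub (λ x → var (ρ x)) A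
ren≡sub ρ (var x) = refl
ren≡sub ρ (A ⇒ B) = cong₂ _⇒_ (ren≡sub ρ A) (ren≡sub ρ B)
ren≡sub ρ (● A)   = cong ● (ren≡sub ρ A)
ren≡sub ρ (μ A)   = cong μ (trans (ren≡sub (extR ρ) A) (sub-cong ext A))
  where
  ext : ∀ x → var (extR ρ x) ≡ extS (λ y → var (ρ y)) x
  ext zero    = refl
  ext (suc x) = refl

unfold-sub : ∀ σ D X → sub (extS σ) D [ X ] ≡ sub (X ∷ₑ σ) D
unfold-sub σ D X = trans (sub-sub (extS σ) (sub0 X) D) (sub-cong ext D)
  where
  ext : ∀ x → sub (sub0 X) (extS σ x) ≡ (X ∷ₑ σ) x
  ext zero    = refl
  ext (suc x) = trans (sub-ren suc (sub0 X) (σ x)) (sub-id (σ x))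

-- tvSpine bs walks the tail of a type; bs records, for each enclosing μ
-- (innermost first), whether a bullet has been passed since it.  The
-- spine ends in a variable bound by one of those μ's, so a substitution
-- that leaves the bound indices alone preserves being a ⊤-variant.

markAll : List Bool → List Bool
markAll = map (const true)

lookup-bound : ∀ bs j → T (lookupB bs j) → j < length bs
lookup-bound []       j       ()
lookup-bound (b ∷ bs) zero    _ = s≤s z≤n
lookup-bound (b ∷ bs) (suc j) t = s≤s (lookup-bound bs j t)

Fixes : ℕ → (ℕ → Ty) → Set
Fixes k σ = ∀ i → i < k → σ i ≡ var i

Fixes-extS : ∀ {k σ} → Fixes k σ → Fixes (suc k) (extS σ)
Fixes-extS fx zero    _        = refl
Fixes-extS fx (suc i) (s≤s lt) = cong (ren suc) (fx i lt)

Fixes-markAll : ∀ {σ} bs → Fixes (length bs) σ → Fixes (length (markAll bs)) σ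
Fixes-markAll {σ} bs = subst (λ k → Fixes k σ) (sym (length-map (const true) bs))

spine-sub : ∀ bs σ A → Fixes (length bs) σ →
            T (tvSpine bs (tail A)) → T (tvSpine bs (tail (sub σ A)))
spine-sub bs σ (var j) fx t =
  subst (λ Z → T (tvSpine bs (tail Z))) (sym (fx j (lookup-bound bs j t))) t
spine-sub bs σ (A ⇒ B) fx t = spine-sub bs σ B fx t
spine-sub bs σ (● A)   fx t = spine-sub (markAll bs) σ A (Fixes-markAll bs fx) t
spine-sub bs σ (μ A)   fx t = spine-sub (false ∷ bs) (extS σ) A (Fixes-extS fx) t

TV-sub : ∀ σ A → TopVariant A → TopVariant (sub σ A)
TV-sub σ A = spine-sub [] σ A (λ i ())

TV-ren : ∀ ρ A → TopVariant A → TopVariant (ren ρ A)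
TV-ren ρ A tv = subst TopVariant (sym (ren≡sub ρ A)) (TV-sub _ A tv)

lookup-++ : ∀ cs ds j → T (lookupB cs j) → T (lookupB (cs ++ ds) j)
lookup-++ (c ∷ cs) ds zero    t = t
lookup-++ (c ∷ cs) ds (suc j) t = lookup-++ cs ds j t

spine-++ : ∀ cs ds B → T (tvSpine cs B) → T (tvSpine (cs ++ ds) B)
spine-++ cs ds (var j) t = lookup-++ cs ds j t
spine-++ cs ds (● B)   t =
  subst (λ L → T (tvSpine L B)) (sym (map-++ (const true) cs ds))
    (spine-++ (markAll cs) (markAll ds) B t)
spine-++ cs ds (μ B)   t = spine-++ (false ∷ cs) ds B t

lookup-snoc : ∀ bs b j → T (lookupB (bs ++ b ∷ []) j) →
              (j < length bs × T (lookupB bs j)) ⊎ j ≡ length bs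
lookup-snoc []       b zero    t = inj₂ refl
lookup-snoc (c ∷ bs) b zero    t = inj₁ (s≤s z≤n , t)
lookup-snoc (c ∷ bs) b (suc j) t with lookup-snoc bs b j t
... | inj₁ (lt , t′) = inj₁ (s≤s lt , t′)
... | inj₂ e         = inj₂ (cong suc e)

spine-unfold : ∀ bs b σ A → Fixes (length bs) σ → TopVariant (σ (length bs)) →
               T (tvSpine (bs ++ b ∷ []) (tail A)) → T (tvSpine bs (tail (sub σ A)))
spine-unfold bs b σ (var j) fx tv t with lookup-snoc bs b j t
... | inj₁ (lt , t′) = subst (λ Z → T (tvSpine bs (tail Z))) (sym (fx j lt)) t′
... | inj₂ refl      = spine-++ [] bs (tail (σ (length bs))) tv
spine-unfold bs b σ (A ⇒ B) fx tv t = spine-unfold bs b σ B fx tv t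
spine-unfold bs b σ (● A)   fx tv t =
  spine-unfold (markAll bs) true σ A (Fixes-markAll bs fx)
    (subst (λ k → TopVariant (σ k)) (sym (length-map (const true) bs)) tv)
    (subst (λ L → T (tvSpine L (tail A))) (map-++ (const true) bs (b ∷ [])) t)
spine-unfold bs b σ (μ A)   fx tv t =
  spine-unfold (false ∷ bs) b (extS σ) A (Fixes-extS fx) (TV-ren suc (σ (length bs)) tv) t

TV-unfold : ∀ A → TopVariant (μ A) → TopVariant (A [ μ A ])
TV-unfold A tv = spine-unfold [] false (sub0 (μ A)) A (λ i ()) tv tv

data NotFree (x : ℕ) : Ty → Set where
  nf-var : ∀ {y} → y ≢ x → NotFree x (var y)
  nf-⇒   : ∀ {A B} → NotFree x A → NotFree x B → NotFree x (A ⇒ B)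
  nf-●   : ∀ {A} → NotFree x A → NotFree x (● A)
  nf-μ   : ∀ {A} → NotFree (suc x) A → NotFree x (μ A)

NotFree⇒Proper : ∀ {x A} → NotFree x A → Proper x A
NotFree⇒Proper (nf-var ne) = p-var ne
NotFree⇒Proper (nf-⇒ a b)  = p-⇒ (NotFree⇒Proper a) (NotFree⇒Proper b)
NotFree⇒Proper (nf-● a)    = p-●
NotFree⇒Proper (nf-μ a)    = p-μ (NotFree⇒Proper a)

NotFree-ren : ∀ {x x′} ρ {A} → NotFree x A → (∀ y → ρ y ≡ x′ → y ≡ x) → NotFree x′ (ren ρ A)
NotFree-ren ρ (nf-var ne) h = nf-var (λ e → ne (h _ e))
NotFree-ren ρ (nf-⇒ a b)  h = nf-⇒ (NotFree-ren ρ a h) (NotFree-ren ρ b h)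
NotFree-ren ρ (nf-● a)    h = nf-● (NotFree-ren ρ a h)
NotFree-ren {x} {x′} ρ (nf-μ a) h = nf-μ (NotFree-ren (extR ρ) a h′)
  where
  h′ : ∀ y → extR ρ y ≡ suc x′ → y ≡ suc x
  h′ zero    ()
  h′ (suc y) e = cong suc (h y (suc-injective e))

NotFree-avoid : ∀ {x′} ρ A → (∀ y → ρ y ≢ x′) → NotFree x′ (ren ρ A)
NotFree-avoid ρ (var y) h = nf-var (h y)
NotFree-avoid ρ (A ⇒ B) h = nf-⇒ (NotFree-avoid ρ A h) (NotFree-avoid ρ B h)
NotFree-avoid ρ (● A)   h = nf-● (NotFree-avoid ρ A h)
NotFree-avoid {x′} ρ (μ A) h = nf-μ (NotFree-avoid (extR ρ) A h′)
  where
  h′ : ∀ y → extR ρ y ≢ suc x′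
  h′ zero    ()
  h′ (suc y) e = h y (suc-injective e)

Proper-sub : ∀ {x x′ D} σ → Proper x D → (∀ y → y ≢ x → NotFree x′ (σ y)) → Proper x′ (sub σ D)
Proper-sub σ (p-var ne)           h = NotFree⇒Proper (h _ ne)
Proper-sub σ p-●                  h = p-●
Proper-sub σ (p-⇒ a b)            h = p-⇒ (Proper-sub σ a h) (Proper-sub σ b h)
Proper-sub σ (p-⇒tv {B = B} tv)   h = p-⇒tv (TV-sub σ B tv)
Proper-sub σ (p-μtv {A} tv)       h = p-μtv (TV-sub σ (μ A) tv)
Proper-sub {x} {x′} σ (p-μ pD)    h = p-μ (Proper-sub (extS σ) pD h′)
  where
  h′ : ∀ y → y ≢ suc x → NotFree (suc x′) (extS σ y)
  h′ zero    _  = nf-var (λ ())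
  h′ (suc y) ne = NotFree-ren suc (h y (λ e → ne (cong suc e))) (λ _ → suc-injective)

Proper-ren : ∀ {x x′ A} ρ → Proper x A → (∀ y → ρ y ≡ x′ → y ≡ x) → Proper x′ (ren ρ A)
Proper-ren {x} {x′} {A} ρ p h =
  subst (Proper x′) (sym (ren≡sub ρ A))
    (Proper-sub (λ y → var (ρ y)) p (λ y ne → nf-var (λ e → ne (h y e))))

TE-ren : ∀ ρ {A} → TypeExpr A → TypeExpr (ren ρ A)
TE-ren ρ te-var     = te-var
TE-ren ρ (te-⇒ a b) = te-⇒ (TE-ren ρ a) (TE-ren ρ b)
TE-ren ρ (te-● a)   = te-● (TE-ren ρ a)
TE-ren ρ (te-μ p t) = te-μ (Proper-ren (extR ρ) p bound) (TE-ren (extR ρ) t)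
  where
  bound : ∀ y → extR ρ y ≡ zero → y ≡ zero
  bound zero    _  = refl
  bound (suc y) ()

TEs : (ℕ → Ty) → Set
TEs σ = ∀ x → TypeExpr (σ x)

TE-sub : ∀ σ {D} → TypeExpr D → TEs σ → TypeExpr (sub σ D)
TE-sub σ (te-var {x}) ts = ts x
TE-sub σ (te-⇒ a b)   ts = te-⇒ (TE-sub σ a ts) (TE-sub σ b ts)
TE-sub σ (te-● a)     ts = te-● (TE-sub σ a ts)
TE-sub σ (te-μ p t)   ts = te-μ (Proper-sub (extS σ) p fresh) (TE-sub (extS σ) t ts′)
  where
  fresh : ∀ y → y ≢ zero → NotFree zero (extS σ y)
  fresh zero    ne = ⊥-elim (ne refl)
  fresh (suc y) _  = NotFree-avoid suc (σ y) (λ _ ())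
  ts′ : TEs (extS σ)
  ts′ zero    = te-var
  ts′ (suc y) = TE-ren suc (ts y)

TEs-∷ : ∀ {X σ} → TypeExpr X → TEs σ → TEs (X ∷ₑ σ)
TEs-∷ tX ts zero    = tX
TEs-∷ tX ts (suc y) = ts y

TEs-sub0 : ∀ {X} → TypeExpr X → TEs (sub0 X)
TEs-sub0 tX zero    = tX
TEs-sub0 tX (suc y) = te-var

TE-unfold : ∀ {A} → TypeExpr (μ A) → TypeExpr (A [ μ A ])
TE-unfold {A} (te-μ p t) = TE-sub (sub0 (μ A)) t (TEs-sub0 (te-μ p t))

TE-Top : TypeExpr Top
TE-Top = te-μ p-● (te-● te-var)

≅-wf : ∀ {A B} → A ≅ B → TypeExpr A × TypeExpr B
≅-wf (≅-refl t)      = t , t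
≅-wf (≅-sym d)       = proj₂ (≅-wf d) , proj₁ (≅-wf d)
≅-wf (≅-trans d e)   = proj₁ (≅-wf d) , proj₂ (≅-wf e)
≅-wf (≅-● d)         = te-● (proj₁ (≅-wf d)) , te-● (proj₂ (≅-wf d))
≅-wf (≅-⇒ d e)       = te-⇒ (proj₁ (≅-wf d)) (proj₁ (≅-wf e)) , te-⇒ (proj₂ (≅-wf d)) (proj₂ (≅-wf e))
≅-wf (≅-⊤ t)         = te-⇒ t TE-Top , TE-Top
≅-wf (≅-unfold t)    = t , TE-unfold t
≅-wf (≅-fix tC pC d) = proj₁ (≅-wf d) , te-μ pC tC

Proper-⇒ˡ : ∀ {x A B} → isTV B ≡ false → Proper x (A ⇒ B) → Proper x A
Proper-⇒ˡ e (p-⇒ a _)  = a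
Proper-⇒ˡ e (p-⇒tv tv) = ⊥-elim (subst T e tv)

Proper-⇒ʳ : ∀ {x A B} → isTV B ≡ false → Proper x (A ⇒ B) → Proper x B
Proper-⇒ʳ e (p-⇒ _ b)  = b
Proper-⇒ʳ e (p-⇒tv tv) = ⊥-elim (subst T e tv)

Proper-μ⁻ : ∀ {x D} → isTV (μ D) ≡ false → Proper x (μ D) → Proper (suc x) D
Proper-μ⁻ e (p-μ d)    = d
Proper-μ⁻ e (p-μtv tv) = ⊥-elim (subst T e tv)

module Soundness (𝔸 : LambdaAlgebra) (𝔽 : Frame) where
  open LambdaAlgebra 𝔸
  open Frame 𝔽
  open Semantics 𝔸 𝔽

  tv? : ∀ A → TopVariant A ⊎ isTV A ≡ false
  tv? A with isTV A
  ... | true  = inj₁ tt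
  ... | false = inj₂ refl

  rank-TV : ∀ A → TopVariant A → rank A ≡ 1
  rank-TV A tv = cong (λ b → if b then 1 else rank′ A) (to T-≡ tv)

  rank-nonTV : ∀ A → isTV A ≡ false → rank A ≡ rank′ A
  rank-nonTV A e = cong (λ b → if b then 1 else rank′ A) e

  rank′≥1 : ∀ A → 1 ≤ rank′ A
  rank′≥1 (var x) = s≤s z≤n
  rank′≥1 (A ⇒ B) = s≤s z≤n
  rank′≥1 (● A)   = s≤s z≤n
  rank′≥1 (μ A)   = s≤s z≤n

  rank≥1 : ∀ A → 1 ≤ rank A
  rank≥1 A with tv? A
  ... | inj₁ tv = subst (1 ≤_) (sym (rank-TV A tv)) ≤-refl
  ... | inj₂ e  = subst (1 ≤_) (sym (rank-nonTV A e)) (rank′≥1 A)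

  RenamesOff : ℕ → (ℕ → Ty) → Set
  RenamesOff x σ = ∀ y → y ≢ x → ∃ λ k → σ y ≡ var k

  -- Substituting in the variable in which C is proper, and renaming the
  -- others, does not increase the rank: the substituted occurrences all
  -- sit below a bullet or in the argument of a ⊤-variant.
  mutual
    rank-sub : ∀ {x} σ C → Proper x C → RenamesOff x σ → rank (sub σ C) ≤ rank C
    rank-sub σ C pr h with tv? (sub σ C) | tv? C
    ... | inj₁ tv | _       = subst (_≤ rank C) (sym (rank-TV (sub σ C) tv)) (rank≥1 C)
    ... | inj₂ e  | inj₁ tv = ⊥-elim (subst T e (TV-sub σ C tv))
    ... | inj₂ e  | inj₂ e′ =
      subst₂ _≤_ (sym (rank-nonTV (sub σ C) e)) (sym (rank-nonTV C e′)) (rank′-sub σ C pr h e′)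

    rank′-sub : ∀ {x} σ C → Proper x C → RenamesOff x σ → isTV C ≡ false →
                rank′ (sub σ C) ≤ rank′ C
    rank′-sub σ (var y) (p-var ne) h _ with h y ne
    ... | k , eq = subst (λ Z → rank′ Z ≤ 1) (sym eq) ≤-refl
    rank′-sub σ (● A)   p-●        h _ = ≤-refl
    rank′-sub σ (A ⇒ B) (p-⇒ a b)  h _ = s≤s (+-mono-≤ (rank-sub σ A a h) (rank-sub σ B b h))
    rank′-sub σ (A ⇒ B) (p-⇒tv tv) h e = ⊥-elim (subst T e tv)
    rank′-sub σ (μ D)   (p-μtv tv) h e = ⊥-elim (subst T e tv)
    rank′-sub {x} σ (μ D) (p-μ pD) h _ = s≤s (rank-sub (extS σ) D pD h′)
      where
      h′ : RenamesOff (suc x) (extS σ)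
      h′ zero    _  = zero , refl
      h′ (suc y) ne with h y (λ e → ne (cong suc e))
      ... | k , eq = suc k , cong (ren suc) eq

  rank-unfold : ∀ A → Proper zero A → rank (A [ μ A ]) ≤ rank A
  rank-unfold A pr = rank-sub (sub0 (μ A)) A pr renames
    where
    renames : RenamesOff zero (sub0 (μ A))
    renames zero    ne = ⊥-elim (ne refl)
    renames (suc y) _  = y , refl

  _◁⁺_ : W → W → Set
  _◁⁺_ = TransClosure _◁_

  descend : ∀ {p q r} → q ◁⁺ p → q ⊵* r → r ◁⁺ p
  descend q◁⁺p ε            = q◁⁺p
  descend q◁⁺p (q▷q′ ◅ path) = descend (q▷q′ ◅⁺ q◁⁺p) path

  module _ (η : Env) where

    I : Ty → W → V → Set
    I A p = 𝓘 A η p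

    ≡⇒⇔ : {X Y : Set} → X ≡ Y → X ⇔ Y
    ≡⇒⇔ refl = ⇔-refl

    J-TV : ∀ {p} (a : Acc _◁_ p) n A u → TopVariant A → J η a n A u
    J-TV a n A u tv = subst (λ b → (if b then (λ _ → ⊤) else J′ η a n A) u) (sym (to T-≡ tv)) tt

    J-nonTV : ∀ {p} (a : Acc _◁_ p) n A u → isTV A ≡ false → J η a n A u ≡ J′ η a n A u
    J-nonTV a n A u e = cong (λ b → (if b then (λ _ → ⊤) else J′ η a n A) u) e

    -- J computes the same predicate whatever the accessibility proof and
    -- whatever fuel beyond the rank; μ-unfolding never raises the rank.
    mutual
      J-irrelevant : ∀ {p} (a a′ : Acc _◁_ p) n m A → TypeExpr A → rank A ≤ n → rank A ≤ m →
                     ∀ u → J η a n A u → J η a′ m A u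
      J-irrelevant a a′ n m A tA rn rm u x with isTV A
      ... | true  = tt
      ... | false = J′-irrelevant a a′ n m A tA rn rm u x

      J′-irrelevant : ∀ {p} (a a′ : Acc _◁_ p) n m A → TypeExpr A → rank′ A ≤ n → rank′ A ≤ m →
                      ∀ u → J′ η a n A u → J′ η a′ m A u
      J′-irrelevant a a′ (suc n) (suc m) (var y) _ _ _ u ηy = ηy
      J′-irrelevant (acc rs) (acc rs′) (suc n) (suc m) (● A) (te-● tA) rn rm u f q h =
        J-irrelevant (rs h) (rs′ h) (rank A) (rank A) A tA ≤-refl ≤-refl u (f q h)
      J′-irrelevant a a′ (suc n) (suc m) (A ⇒ B) (te-⇒ tA tB) (s≤s rn) (s≤s rm) u f q path v x =
        At-irrelevant a a′ path n m B tB (≤-trans rB rn) (≤-trans rB rm) (u ∙ v)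
          (f q path v (At-irrelevant a′ a path m n A tA (≤-trans rA rm) (≤-trans rA rn) v x))
        where
        rA = m≤m+n (rank A) (rank B)
        rB = m≤n+m (rank B) (rank A)
      J′-irrelevant a a′ (suc n) (suc m) (μ A) (te-μ pA tA) (s≤s rn) (s≤s rm) u x =
        J-irrelevant a a′ n m (A [ μ A ]) (TE-unfold (te-μ pA tA))
          (≤-trans (rank-unfold A pA) rn) (≤-trans (rank-unfold A pA) rm) u x

      At-irrelevant : ∀ {p q} (a a′ : Acc _◁_ p) (path : p ⊵* q) n m A → TypeExpr A →
                      rank A ≤ n → rank A ≤ m → ∀ v → At η a path n A v → At η a′ path m A v
      At-irrelevant a a′ ε n m A tA rn rm v x = J-irrelevant a a′ n m A tA rn rm v x
      At-irrelevant (acc rs) (acc rs′) (h ◅ path) n m A tA _ _ v x =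
        At-irrelevant (rs h) (rs′ h) path (rank A) (rank A) A tA ≤-refl ≤-refl v x

    At-char : ∀ {p q} (a : Acc _◁_ p) (path : p ⊵* q) n A → TypeExpr A → rank A ≤ n →
              ∀ v → At η a path n A v ⇔ I A q v
    At-char {p} a ε n A tA rn v =
      mk⇔ (J-irrelevant a (wf p) n (rank A) A tA rn ≤-refl v)
          (J-irrelevant (wf p) a (rank A) n A tA ≤-refl rn v)
    At-char (acc rs) (h ◅ path) n A tA rn v = At-char (rs h) path (rank A) A tA ≤-refl v

    I-TV : ∀ {p} A u → TopVariant A → I A p u
    I-TV {p} A u = J-TV (wf p) (rank A) A u

    I-nonTV : ∀ {p} A u → isTV A ≡ false → I A p u ≡ J′ η (wf p) (rank′ A) A u
    I-nonTV {p} A u e =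
      trans (J-nonTV (wf p) (rank A) A u e) (cong (λ n → J′ η (wf p) n A u) (rank-nonTV A e))

    I-⇒ : ∀ {p} A B → TypeExpr A → TypeExpr B → ∀ u →
          I (A ⇒ B) p u ⇔ (∀ q → p ⊵* q → ∀ v → I A q v → I B q (u ∙ v))
    I-⇒ {p} A B tA tB u with tv? B
    ... | inj₁ tv = mk⇔ (λ _ q _ v _ → I-TV B (u ∙ v) tv) (λ _ → I-TV (A ⇒ B) u tv)
    ... | inj₂ e  = ⇔-trans (≡⇒⇔ (I-nonTV (A ⇒ B) u e)) (mk⇔
        (λ f q path v x → to (B-char path (u ∙ v)) (f q path v (from (A-char path v) x)))
        (λ g q path v x → from (B-char path (u ∙ v)) (g q path v (to (A-char path v) x))))
      where
      A-char : ∀ {q} (path : p ⊵* q) v → At η (wf p) path (rank A + rank B) A v ⇔ I A q v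
      A-char path = At-char (wf p) path _ A tA (m≤m+n (rank A) (rank B))
      B-char : ∀ {q} (path : p ⊵* q) v → At η (wf p) path (rank A + rank B) B v ⇔ I B q v
      B-char path = At-char (wf p) path _ B tB (m≤n+m (rank B) (rank A))

    -- The • clause of J′ quantifies over successors with their own
    -- accessibility proofs; by irrelevance these may be replaced by wf.
    ●-char : ∀ {p} (a : Acc _◁_ p) A → TypeExpr A → ∀ u →
             J′ η a 1 (● A) u ⇔ (∀ q → p ▷ q → I A q u)
    ●-char (acc rs) A tA u = mk⇔
      (λ f q h → J-irrelevant (rs h) (wf q) (rank A) (rank A) A tA ≤-refl ≤-refl u (f q h))
      (λ f q h → J-irrelevant (wf q) (rs h) (rank A) (rank A) A tA ≤-refl ≤-refl u (f q h))

    I-● : ∀ {p} A → TypeExpr A → ∀ u → I (● A) p u ⇔ (∀ q → p ▷ q → I A q u)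
    I-● {p} A tA u with tv? A
    ... | inj₁ tv = mk⇔ (λ _ q _ → I-TV A u tv) (λ _ → I-TV (● A) u tv)
    ... | inj₂ e  = ⇔-trans (≡⇒⇔ (I-nonTV (● A) u e)) (●-char (wf p) A tA u)

    I-μ : ∀ {p} A → TypeExpr (μ A) → ∀ u → I (μ A) p u ⇔ I (A [ μ A ]) p u
    I-μ {p} A tμ u with tv? (μ A)
    ... | inj₁ tv = mk⇔ (λ _ → I-TV (A [ μ A ]) u (TV-unfold A tv)) (λ _ → I-TV (μ A) u tv)
    I-μ {p} A tμ@(te-μ pA _) u | inj₂ e = ⇔-trans (≡⇒⇔ (I-nonTV (μ A) u e)) (mk⇔
        (J-irrelevant (wf p) (wf p) (rank A) (rank (A [ μ A ])) (A [ μ A ]) tU (rank-unfold A pA) ≤-refl u)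
        (J-irrelevant (wf p) (wf p) (rank (A [ μ A ])) (rank A) (A [ μ A ]) tU ≤-refl (rank-unfold A pA) u))
      where
      tU = TE-unfold tμ

    record Agree (A B : Ty) (r : W) : Set where
      constructor agree
      field at : ∀ u → I A r u ⇔ I B r u
    open Agree

    Agree-refl : ∀ {A r} → Agree A A r
    Agree-refl = agree (λ u → ⇔-refl)

    Agree-sym : ∀ {A B r} → Agree A B r → Agree B A r
    Agree-sym ag = agree (λ u → ⇔-sym (at ag u))

    Agree-trans : ∀ {A B C r} → Agree A B r → Agree B C r → Agree A C r
    Agree-trans ag ag′ = agree (λ u → ⇔-trans (at ag u) (at ag′ u))

    Agree-≡ : ∀ {A B r} → A ≡ B → Agree A B r
    Agree-≡ refl = Agree-refl

    Agree-TV : ∀ {A B r} → TopVariant A → TopVariant B → Agree A B r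
    Agree-TV {A} {B} tvA tvB = agree (λ u → mk⇔ (λ _ → I-TV B u tvB) (λ _ → I-TV A u tvA))

    Agree-μ : ∀ {A r} → TypeExpr (μ A) → Agree (μ A) (A [ μ A ]) r
    Agree-μ {A} tμ = agree (I-μ A tμ)

    Agree-⊵* : ∀ {A B p} → Agree A B p → (∀ {r} → r ◁⁺ p → Agree A B r) → ∀ q → p ⊵* q → Agree A B q
    Agree-⊵* here below q ε            = here
    Agree-⊵* here below q (p▷p′ ◅ path) = below (descend [ p▷p′ ]⁺ path)

    ●-agree : ∀ {A B p} → TypeExpr A → TypeExpr B → (∀ q → p ▷ q → Agree A B q) → Agree (● A) (● B) p
    ●-agree {A} {B} tA tB ag = agree λ u → ⇔-trans (I-● A tA u) (⇔-trans
      (mk⇔ (λ f q h → to (at (ag q h) u) (f q h)) (λ g q h → from (at (ag q h) u) (g q h)))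
      (⇔-sym (I-● B tB u)))

    ⇒-agree : ∀ {A B C D p} → TypeExpr A → TypeExpr B → TypeExpr C → TypeExpr D →
              (∀ q → p ⊵* q → Agree A C q) → (∀ q → p ⊵* q → Agree B D q) → Agree (A ⇒ B) (C ⇒ D) p
    ⇒-agree {A} {B} {C} {D} tA tB tC tD agAC agBD = agree λ u → ⇔-trans (I-⇒ A B tA tB u) (⇔-trans
      (mk⇔ (λ f q path v x → to (at (agBD q path) (u ∙ v)) (f q path v (from (at (agAC q path) v) x)))
           (λ g q path v x → from (at (agBD q path) (u ∙ v)) (g q path v (to (at (agAC q path) v) x))))
      (⇔-sym (I-⇒ C D tC tD u)))

    _≈_at_ : (ℕ → Ty) → (ℕ → Ty) → W → Set
    σ ≈ τ at r = ∀ x → Agree (σ x) (τ x) r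

    _≈_below_ : (ℕ → Ty) → (ℕ → Ty) → W → Set
    σ ≈ τ below p = ∀ {r} → r ◁⁺ p → σ ≈ τ at r

    Guarded : W → Ty → (ℕ → Ty) → (ℕ → Ty) → Set
    Guarded p C σ τ = ∀ x → Proper x C ⊎ Agree (σ x) (τ x) p

    Guarded-mono : ∀ {p C C′ σ τ} → (∀ {x} → Proper x C → Proper x C′) →
                   Guarded p C σ τ → Guarded p C′ σ τ
    Guarded-mono f gd x = map₁ f (gd x)

    Guarded-μ : ∀ {p D σ τ X Y} → isTV (μ D) ≡ false → Proper zero D →
                Guarded p (μ D) σ τ → Guarded p D (X ∷ₑ σ) (Y ∷ₑ τ)
    Guarded-μ e pD gd zero    = inj₁ pD
    Guarded-μ e pD gd (suc y) = map₁ (Proper-μ⁻ e) (gd y)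

    ≈below-∷ : ∀ {p X Y σ τ} → (∀ {r} → r ◁⁺ p → Agree X Y r) → σ ≈ τ below p →
               (X ∷ₑ σ) ≈ (Y ∷ₑ τ) below p
    ≈below-∷ agXY agστ r◁⁺p zero    = agXY r◁⁺p
    ≈below-∷ agXY agστ r◁⁺p (suc y) = agστ r◁⁺p y

    Contractive : W → Set
    Contractive p = ∀ C σ τ → TypeExpr C → TEs σ → TEs τ →
                    σ ≈ τ below p → Guarded p C σ τ → Agree (sub σ C) (sub τ C) p

    module ContractiveStep {p} (ih : ∀ {r} → r ◁⁺ p → Contractive r) where

      -- Strictly below p, agreement of σ and τ is total, so the
      -- hypothesis ih applies to every C.
      below : ∀ C {σ τ} → TypeExpr C → TEs σ → TEs τ → σ ≈ τ below p →
              ∀ {r} → r ◁⁺ p → Agree (sub σ C) (sub τ C) r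
      below C tC tσ tτ ag r◁⁺p =
        ih r◁⁺p C _ _ tC tσ tτ (λ r′◁⁺r → ag (r′◁⁺r ◅◅⁺ r◁⁺p)) (λ x → inj₂ (ag r◁⁺p x))

      unfold-agree : ∀ {r} σ D → TypeExpr (sub σ (μ D)) →
                     Agree (sub σ (μ D)) (sub (sub σ (μ D) ∷ₑ σ) D) r
      unfold-agree σ D tμ = Agree-trans (Agree-μ tμ) (Agree-≡ (unfold-sub σ D _))

      -- The • case moves strictly below
      -- p; the ⇒ case needs agreement along ⊵*, i.e. at p (recursion on the
      -- components) and below p; the μ case unfolds both sides, making the
      -- bound variable guarded.
      mutual
        contract : ∀ n C σ τ → rank C ≤ n → TypeExpr C → TEs σ → TEs τ →
                   σ ≈ τ below p → Guarded p C σ τ → Agree (sub σ C) (sub τ C) p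
        contract n C σ τ rn tC tσ tτ ag gd with tv? C
        ... | inj₁ tv = Agree-TV (TV-sub σ C tv) (TV-sub τ C tv)
        ... | inj₂ e  = contract′ n C σ τ (subst (_≤ n) (rank-nonTV C e) rn) tC tσ tτ ag gd e

        contract′ : ∀ n C σ τ → rank′ C ≤ n → TypeExpr C → TEs σ → TEs τ →
                    σ ≈ τ below p → Guarded p C σ τ → isTV C ≡ false → Agree (sub σ C) (sub τ C) p
        contract′ n (var y) σ τ _ _ _ _ _ gd _ with gd y
        ... | inj₁ (p-var ne) = ⊥-elim (ne refl)
        ... | inj₂ agy        = agy
        contract′ n (● C) σ τ _ (te-● tC) tσ tτ ag _ _ =
          ●-agree (TE-sub σ tC tσ) (TE-sub τ tC tτ) (λ q h → below C tC tσ tτ ag [ h ]⁺)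
        contract′ (suc n) (C₁ ⇒ C₂) σ τ (s≤s rn) (te-⇒ t₁ t₂) tσ tτ ag gd e =
          ⇒-agree (TE-sub σ t₁ tσ) (TE-sub σ t₂ tσ) (TE-sub τ t₁ tτ) (TE-sub τ t₂ tτ)
            (Agree-⊵* (contract n C₁ σ τ (≤-trans (m≤m+n _ _) rn) t₁ tσ tτ ag
                                    (Guarded-mono (Proper-⇒ˡ e) gd))
                      (below C₁ t₁ tσ tτ ag))
            (Agree-⊵* (contract n C₂ σ τ (≤-trans (m≤n+m _ _) rn) t₂ tσ tτ ag
                                    (Guarded-mono (Proper-⇒ʳ e) gd))
                      (below C₂ t₂ tσ tτ ag))
        contract′ (suc n) (μ D) σ τ (s≤s rn) tC@(te-μ pD tD) tσ tτ ag gd e =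
          Agree-trans (unfold-agree σ D tμσ)
            (Agree-trans
              (contract n D _ _ rn tD (TEs-∷ tμσ tσ) (TEs-∷ tμτ tτ)
                 (≈below-∷ (below (μ D) tC tσ tτ ag) ag) (Guarded-μ e pD gd))
              (Agree-sym (unfold-agree τ D tμτ)))
          where
          tμσ = TE-sub σ tC tσ
          tμτ = TE-sub τ tC tτ

    contractive : ∀ p → Contractive p
    contractive = All.wfRec (wellFounded _◁_ wf) 0ℓ Contractive
      (λ p ih C σ τ tC → ContractiveStep.contract ih (rank C) C σ τ ≤-refl tC)

    -- A type agreeing everywhere with C[A] agrees with μC: the fixed point
    -- of a proper C is unique, by well-founded induction on worlds.
    fix-agree : ∀ {A C} → TypeExpr A → TypeExpr C → Proper zero C →
                (∀ p → Agree A (C [ A ]) p) → ∀ p → Agree A (μ C) p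
    fix-agree {A} {C} tA tC pC unfolds = All.wfRec (wellFounded _◁_ wf) 0ℓ (Agree A (μ C)) step
      where
      tμ : TypeExpr (μ C)
      tμ = te-μ pC tC

      step : ∀ p → (∀ {r} → r ◁⁺ p → Agree A (μ C) r) → Agree A (μ C) p
      step p ih =
        Agree-trans (unfolds p)
          (Agree-trans
            (contractive p C (sub0 A) (sub0 (μ C)) tC (TEs-sub0 tA) (TEs-sub0 tμ) agBelow guarded)
            (Agree-sym (Agree-μ tμ)))
        where
        agBelow : sub0 A ≈ sub0 (μ C) below p
        agBelow r◁⁺p zero    = ih r◁⁺p
        agBelow r◁⁺p (suc y) = Agree-refl
        guarded : Guarded p C (sub0 A) (sub0 (μ C))
        guarded zero    = inj₁ pC
        guarded (suc y) = inj₂ Agree-refl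

    ≅-sound : ∀ {A B} → A ≅ B → ∀ p → Agree A B p
    ≅-sound (≅-refl _)      p = Agree-refl
    ≅-sound (≅-sym d)       p = Agree-sym (≅-sound d p)
    ≅-sound (≅-trans d e)   p = Agree-trans (≅-sound d p) (≅-sound e p)
    ≅-sound (≅-● d)         p = ●-agree (proj₁ (≅-wf d)) (proj₂ (≅-wf d)) (λ q _ → ≅-sound d q)
    ≅-sound (≅-⇒ d e)       p =
      ⇒-agree (proj₁ (≅-wf d)) (proj₁ (≅-wf e)) (proj₂ (≅-wf d)) (proj₂ (≅-wf e))
        (λ q _ → ≅-sound d q) (λ q _ → ≅-sound e q)
    ≅-sound (≅-⊤ _)         p = Agree-TV tt tt
    ≅-sound (≅-unfold t)    p = Agree-μ t
    ≅-sound (≅-fix tC pC d) p = fix-agree (proj₁ (≅-wf d)) tC pC (≅-sound d) p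

-- Theorem 4.7.
theorem4p7 : (𝔸 : LambdaAlgebra) (𝔽 : Frame) {A B : Ty} → A ≅ B →
    (η : Semantics.Env 𝔸 𝔽) → Semantics.Hereditary 𝔸 𝔽 η →
    (p : Frame.W 𝔽) (u : LambdaAlgebra.V 𝔸) →
    (Semantics.𝓘 𝔸 𝔽 A η p u ⇔ Semantics.𝓘 𝔸 𝔽 B η p u)
theorem4p7 𝔸 𝔽 A≅B η _ p = Agree.at (≅-sound η A≅B p)
  where open Soundness 𝔸 𝔽
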